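{- Let $G=C(n,p)$ be a cycle permutation graph with $n>5$, with outer cycle $u_0u_1\cdots u_{n-1}$ and inner cycle $v_0v_1\cdots v_{n-1}$. Then there exist two distinct edges $u_iv_j, u_hv_k\in E(G)$ (with $i\neq h$, $j\neq k$) such that neither $u_iu_h$ nor $v_jv_k$ is an edge of $G$.
   Context: A cycle permutation graph is a cubic graph of order $2n$ that admits a $2$-factor consisting of two disjoint chordless $n$-cycles $C_1$ and $C_2$. For a permutation $p$ of $\{0,\dots,n-1\}$, $C(n,p)$ denotes the cycle permutation graph with vertices $u_0,\dots,u_{n-1}$ (cycle $C_1$, edges $u_iu_{i+1}$) and $v_0,\dots,v_{n-1}$ (cycle $C_2$, edges $v_iv_{i+1}$), indices modulo $n$, together with the perfect matching consisting of the edges $v_iu_{p(i)}$. -}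

module Defs where

open import Data.Nat using (ℕ; suc; zero)
open import Data.Fin using (Fin; toℕ)
open import Data.Fin.Permutation using (Permutation′; _⟨$⟩ʳ_)
open import Data.Product using (_×_)
open import Data.Sum using (_⊎_)
open import Relation.Binary.PropositionalEquality using (_≡_)

CycSucc : {n : ℕ} → Fin n → Fin n → Set
CycSucc {n} a b = (suc (toℕ a) ≡ toℕ b) ⊎ ((suc (toℕ a) ≡ n) × (toℕ b ≡ 0))

data Vertex (n : ℕ) : Set where
  u : Fin n → Vertex n
  v : Fin n → Vertex n

data Adj {n : ℕ} (p : Permutation′ n) : Vertex n → Vertex n → Set where
  uu-succ : ∀ {a b} → CycSucc a b → Adj p (u a) (u b)
  uu-pred : ∀ {a b} → CycSucc b a → Adj p (u a) (u b)
  vv-succ : ∀ {a b} → CycSucc a b → Adj p (v a) (v b)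
  vv-pred : ∀ {a b} → CycSucc b a → Adj p (v a) (v b)
  vu : ∀ {i j} → p ⟨$⟩ʳ j ≡ i → Adj p (v j) (u i)
  uv : ∀ {i j} → p ⟨$⟩ʳ j ≡ i → Adj p (u i) (v j)

-- The inner vertex v₀ is adjacent on C₂ to none of v₂, v₃, v₄, because n > 5.
-- Their partners u_{p(2)}, u_{p(3)}, u_{p(4)} are three distinct vertices of C₁,
-- while u_{p(0)} has only two neighbours on C₁; so some k ∈ {2,3,4} gives the
-- required pair of spokes u_{p(0)}v₀ and u_{p(k)}v_k.
module Submission where

open import Defs
open import Data.Nat using (ℕ; _<_; suc; s≤s; z≤n)
open import Data.Nat.Properties using (<-irrefl; <-trans; n<1+n; suc-injective)
import Data.Nat as ℕ
open import Data.Fin using (Fin; toℕ; zero)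
open import Data.Fin.Patterns using (2F; 3F; 4F)
open import Data.Fin.Properties using (toℕ-injective; toℕ<n)
open import Data.Fin.Permutation using (Permutation′; _⟨$⟩ʳ_)
open import Data.Product using (_×_; ∃-syntax; _,_)
open import Data.Sum using (_⊎_; inj₁; inj₂; [_,_]′)
open import Data.Empty using (⊥-elim)
open import Function using (_∘_; Injection)
open import Function.Properties.Inverse using (↔⇒↣)
open import Relation.Nullary using (¬_; Dec; yes; no)
open import Relation.Nullary.Decidable using (_⊎-dec_; _×-dec_)
open import Relation.Binary.PropositionalEquality using (_≢_; _≡_; refl; sym; trans; subst)

private
  variable
    n : ℕ
    a b c x : Fin n

CycSucc-functional : CycSucc x a → CycSucc x b → a ≡ b
CycSucc-functional (inj₁ x+1≡a) (inj₁ x+1≡b) = toℕ-injective (trans (sym x+1≡a) x+1≡b)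
CycSucc-functional {a = a} (inj₁ x+1≡a) (inj₂ (x+1≡n , _)) =
  ⊥-elim (<-irrefl (trans (sym x+1≡a) x+1≡n) (toℕ<n a))
CycSucc-functional {b = b} (inj₂ (x+1≡n , _)) (inj₁ x+1≡b) =
  ⊥-elim (<-irrefl (trans (sym x+1≡b) x+1≡n) (toℕ<n b))
CycSucc-functional (inj₂ (_ , a≡0)) (inj₂ (_ , b≡0)) = toℕ-injective (trans a≡0 (sym b≡0))

CycSucc-injective : CycSucc a x → CycSucc b x → a ≡ b
CycSucc-injective (inj₁ a+1≡x) (inj₁ b+1≡x) = toℕ-injective (suc-injective (trans a+1≡x (sym b+1≡x)))
CycSucc-injective (inj₁ a+1≡x) (inj₂ (_ , x≡0)) with () ← trans a+1≡x x≡0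
CycSucc-injective (inj₂ (_ , x≡0)) (inj₁ b+1≡x) with () ← trans b+1≡x x≡0
CycSucc-injective (inj₂ (a+1≡n , _)) (inj₂ (b+1≡n , _)) = toℕ-injective (suc-injective (trans a+1≡n (sym b+1≡n)))

CycSucc? : (a b : Fin n) → Dec (CycSucc a b)
CycSucc? {n} a b = (suc (toℕ a) ℕ.≟ toℕ b) ⊎-dec ((suc (toℕ a) ℕ.≟ n) ×-dec (toℕ b ℕ.≟ 0))

CycAdj : Fin n → Fin n → Set
CycAdj a b = CycSucc a b ⊎ CycSucc b a

CycAdj? : (a b : Fin n) → Dec (CycAdj a b)
CycAdj? a b = CycSucc? a b ⊎-dec CycSucc? b a

CycAdj-at-most-two : a ≢ b → a ≢ c → b ≢ c → CycAdj x a → CycAdj x b → ¬ CycAdj x c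
CycAdj-at-most-two a≢b _   _   (inj₁ x→a) (inj₁ x→b) _          = a≢b (CycSucc-functional x→a x→b)
CycAdj-at-most-two a≢b _   _   (inj₂ a→x) (inj₂ b→x) _          = a≢b (CycSucc-injective a→x b→x)
CycAdj-at-most-two _   a≢c _   (inj₁ x→a) (inj₂ _)   (inj₁ x→c) = a≢c (CycSucc-functional x→a x→c)
CycAdj-at-most-two _   _   b≢c (inj₁ _)   (inj₂ b→x) (inj₂ c→x) = b≢c (CycSucc-injective b→x c→x)
CycAdj-at-most-two _   _   b≢c (inj₂ _)   (inj₁ x→b) (inj₁ x→c) = b≢c (CycSucc-functional x→b x→c)
CycAdj-at-most-two _   a≢c _   (inj₂ a→x) (inj₁ _)   (inj₂ c→x) = a≢c (CycSucc-injective a→x c→x)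

¬CycAdj-one-of-three : a ≢ b → a ≢ c → b ≢ c → ¬ CycAdj x a ⊎ ¬ CycAdj x b ⊎ ¬ CycAdj x c
¬CycAdj-one-of-three {a = a} {b = b} {x = x} a≢b a≢c b≢c with CycAdj? x a | CycAdj? x b
... | no ¬xa  | _        = inj₁ ¬xa
... | yes _   | no ¬xb   = inj₂ (inj₁ ¬xb)
... | yes xa  | yes xb   = inj₂ (inj₂ (CycAdj-at-most-two a≢b a≢c b≢c xa xb))

¬CycAdj-zero : ∀ {k : Fin (suc n)} → 1 < toℕ k → suc (toℕ k) < suc n → ¬ CycAdj zero k
¬CycAdj-zero 1<k _     (inj₁ (inj₁ 1≡k))         = <-irrefl 1≡k 1<k
¬CycAdj-zero 1<k _     (inj₁ (inj₂ (_ , k≡0)))   with () ← subst (1 <_) k≡0 1<k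
¬CycAdj-zero _   k+1<n (inj₂ (inj₂ (k+1≡n , _))) = <-irrefl k+1≡n k+1<n

module _ {p : Permutation′ n} where

  Adj-uu⇒CycAdj : Adj p (u a) (u b) → CycAdj a b
  Adj-uu⇒CycAdj (uu-succ a→b) = inj₁ a→b
  Adj-uu⇒CycAdj (uu-pred b→a) = inj₂ b→a

  Adj-vv⇒CycAdj : Adj p (v a) (v b) → CycAdj a b
  Adj-vv⇒CycAdj (vv-succ a→b) = inj₁ a→b
  Adj-vv⇒CycAdj (vv-pred b→a) = inj₂ b→a

  permute-≢ : a ≢ b → p ⟨$⟩ʳ a ≢ p ⟨$⟩ʳ b
  permute-≢ a≢b = a≢b ∘ Injection.injective (↔⇒↣ p)

  separated-spokes : ∀ {j k} → j ≢ k → ¬ CycAdj j k → ¬ CycAdj (p ⟨$⟩ʳ j) (p ⟨$⟩ʳ k) →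
    ∃[ i ] ∃[ j ] ∃[ h ] ∃[ k ]
      (Adj p (u i) (v j) × Adj p (u h) (v k) × i ≢ h × j ≢ k
        × ¬ Adj p (u i) (u h) × ¬ Adj p (v j) (v k))
  separated-spokes {j} {k} j≢k ¬jk ¬pjpk =
    p ⟨$⟩ʳ j , j , p ⟨$⟩ʳ k , k , uv refl , uv refl , permute-≢ j≢k , j≢k ,
    ¬pjpk ∘ Adj-uu⇒CycAdj , ¬jk ∘ Adj-vv⇒CycAdj

lemma2 : (n : ℕ) → 5 < n → (p : Permutation′ n) →
    ∃[ i ] ∃[ j ] ∃[ h ] ∃[ k ]
      (Adj p (u i) (v j) × Adj p (u h) (v k) × i ≢ h × j ≢ k
        × ¬ Adj p (u i) (u h) × ¬ Adj p (v j) (v k))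
lemma2 n 5<n@(s≤s (s≤s (s≤s (s≤s (s≤s (s≤s _)))))) p =
  [ separated-spokes (λ ()) (¬CycAdj-zero (s≤s (s≤s z≤n)) 3<n)
  , [ separated-spokes (λ ()) (¬CycAdj-zero (s≤s (s≤s z≤n)) 4<n)
    , separated-spokes (λ ()) (¬CycAdj-zero (s≤s (s≤s z≤n)) 5<n) ]′ ]′
  (¬CycAdj-one-of-three (permute-≢ {p = p} {2F} {3F} (λ ()))
                        (permute-≢ {p = p} {2F} {4F} (λ ()))
                        (permute-≢ {p = p} {3F} {4F} (λ ())))
  where
  4<n : 4 < n
  4<n = <-trans (n<1+n 4) 5<n
  3<n : 3 < n
  3<n = <-trans (n<1+n 3) 4<n
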